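{- Let $C$ be a cyclically ordered set and $T^\infty(C)=\bigcup_n T^n(C)$, the union along the inclusions $\iota$. Then $T^\infty(C)$ is a cyclically ordered set and $\iota:C\to T^\infty(C)$ is an embedding; $C\mapsto T^\infty(C)$, $f\mapsto T^\infty(f)$ is functorial and $\iota$ is natural. Moreover, if $C$ is nonempty, then $T^\infty(C)$ is a model of the theory of dense cyclically ordered sets with at least two elements.
   Context: A cyclically ordered set is a set $S$ with a ternary relation $R$ satisfying: (Asymmetry) $R(x,y,z)\wedge R(x,z,w)\rightarrow y\neq w$; (Transitivity) $R(x,y,z)\wedge R(x,z,w)\rightarrow R(x,y,w)$; (Connectedness) for pairwise distinct $x,y,z$, $R(x,y,z)$ or $R(z,y,x)$; (Cyclicity) $R(x,y,z)\rightarrow R(y,z,x)$. An embedding $f:C\to D$ is an injective map with $R_C(a,b,c)\leftrightarrow R_D(f(a),f(b),f(c))$. For a cyclically ordered set $C$, $T(C)=C\times\{0,1\}$, where $C\times\{0\}$ carries the cyclic order of $C$ and each $(c,1)$ is placed in the cut immediately after $(c,0)$ (so $R((x,0),(x,1),y)$ for all $y\ne (x,0),(x,1)$); $\iota_C:C\to T(C)$ is $c\mapsto(c,0)$, and $T(f)(c,i)=(f(c),i)$. $T^n$ is the $n$-fold iterate, and $T^\infty(f)$ is the map induced on unions. A cyclically ordered set is dense if for all $x\ne z$ there is $y$ with $R(x,y,z)$. -}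

module Defs where

open import Data.Nat using (ℕ; zero; suc; _+_)
open import Data.Bool using (Bool; true; false)
open import Data.Product using (Σ; _×_; _,_; ∃; ∃₂; proj₁; proj₂)
open import Data.Sum using (_⊎_)
open import Relation.Nullary using (¬_)
open import Relation.Binary.PropositionalEquality using (_≡_)
open import Relation.Binary.Structures using (IsEquivalence)
open import Function using (_∘_; id; _⇔_)

-- Cyclic orders, stated relative to an equality relation _≈_
-- (for ordinary sets _≈_ is _≡_; the colimit T^∞(C) is a setoid).

Ternary : Set → Set₁
Ternary A = A → A → A → Set

record IsCyclicOrder {A : Set} (_≈_ : A → A → Set) (R : Ternary A) : Set where
  field
    isEquivalence : IsEquivalence _≈_
    resp          : ∀ {x x′ y y′ z z′} → x ≈ x′ → y ≈ y′ → z ≈ z′ →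
                    R x y z → R x′ y′ z′
    asymmetry     : ∀ {x y z w} → R x y z → R x z w → ¬ (y ≈ w)
    transitivity  : ∀ {x y z w} → R x y z → R x z w → R x y w
    connectedness : ∀ {x y z} → ¬ (x ≈ y) → ¬ (y ≈ z) → ¬ (x ≈ z) →
                    R x y z ⊎ R z y x
    cyclicity     : ∀ {x y z} → R x y z → R y z x

record RawCyclic : Set₁ where
  field
    Carrier : Set
    R       : Ternary Carrier
open RawCyclic public

record CyclicSet : Set₁ where
  field
    raw      : RawCyclic
    isCyclic : IsCyclicOrder (_≡_ {A = Carrier raw}) (R raw)
open CyclicSet public

IsEmbedding : {A B : Set} (_≈A_ : A → A → Set) (RA : Ternary A)
              (_≈B_ : B → B → Set) (RB : Ternary B) → (A → B) → Set
IsEmbedding {A} _≈A_ RA _≈B_ RB f =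
  (∀ {a b : A} → f a ≈B f b → a ≈A b) ×
  (∀ {a b c : A} → RA a b c ⇔ RB (f a) (f b) (f c))

Embedding : (C D : CyclicSet) → (Carrier (raw C) → Carrier (raw D)) → Set
Embedding C D = IsEmbedding _≡_ (R (raw C)) _≡_ (R (raw D))

-- The construction T: C × {0,1}, (c,1) placed immediately after (c,0).
-- This is the lexicographic product of the cyclic order on C with the
-- linear order 0 < 1 (false = 0, true = 1).

_<ᵇ_ : Bool → Bool → Set
i <ᵇ j = (i ≡ false) × (j ≡ true)

TR : (A : Set) → Ternary A → Ternary (A × Bool)
TR A RA (a , i) (b , j) (c , k) =
     RA a b c
  ⊎ (a ≡ b × ¬ (b ≡ c) × i <ᵇ j)
  ⊎ (b ≡ c × ¬ (c ≡ a) × j <ᵇ k)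
  ⊎ (c ≡ a × ¬ (a ≡ b) × k <ᵇ i)

T : RawCyclic → RawCyclic
T C = record { Carrier = Carrier C × Bool ; R = TR (Carrier C) (R C) }

Tmap : {A B : Set} → (A → B) → A × Bool → B × Bool
Tmap f (a , i) = (f a , i)

Tⁿ : ℕ → RawCyclic → RawCyclic
Tⁿ zero    C = C
Tⁿ (suc n) C = T (Tⁿ n C)

Tⁿmap : (n : ℕ) {C D : RawCyclic} → (Carrier C → Carrier D) →
        Carrier (Tⁿ n C) → Carrier (Tⁿ n D)
Tⁿmap zero    f = f
Tⁿmap (suc n) f = Tmap (Tⁿmap n f)

ι : {A : Set} → A → A × Bool
ι a = (a , false)

ιs : (k : ℕ) {n : ℕ} {C : RawCyclic} → Carrier (Tⁿ n C) → Carrier (Tⁿ (k + n) C)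
ιs zero    x = x
ιs (suc k) x = ι (ιs k x)

-- T^∞(C): the union (directed colimit) of T^0 C → T^1 C → T^2 C → …
-- along ι.  Elements are pairs (n , x) with x ∈ T^n C, identified when
-- they become equal after applying ι sufficiently often.

T∞ : RawCyclic → Set
T∞ C = Σ ℕ (λ n → Carrier (Tⁿ n C))

raise : {C : RawCyclic} → ℕ → T∞ C → T∞ C
raise k (n , x) = (k + n , ιs k x)

_≈∞_ : {C : RawCyclic} → T∞ C → T∞ C → Set
p ≈∞ q = ∃₂ λ k l → raise k p ≡ raise l q

R∞ : {C : RawCyclic} → Ternary (T∞ C)
R∞ {C} p q r = Σ ℕ λ N → Σ (Carrier (Tⁿ N C)) λ x → Σ (Carrier (Tⁿ N C)) λ y →
  Σ (Carrier (Tⁿ N C)) λ z →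
  (p ≈∞ (N , x)) × (q ≈∞ (N , y)) × (r ≈∞ (N , z)) × R (Tⁿ N C) x y z

ι∞ : {C : RawCyclic} → Carrier C → T∞ C
ι∞ c = (0 , c)

T∞map : {C D : RawCyclic} → (Carrier C → Carrier D) → T∞ C → T∞ D
T∞map f (n , x) = (n , Tⁿmap n f x)

Dense : {A : Set} (_≈_ : A → A → Set) (R : Ternary A) → Set
Dense {A} _≈_ R = ∀ {x z : A} → ¬ (x ≈ z) → ∃ λ y → R x y z

AtLeastTwo : {A : Set} (_≈_ : A → A → Set) → Set
AtLeastTwo {A} _≈_ = ∃₂ λ (x y : A) → ¬ (x ≈ y)

{-# OPTIONS --safe #-}
module Submission where

-- T(C) is the lexicographic product of C with the chain 0 < 1, which is again a cyclic order;
-- only connectedness needs excluded middle, to decide equality in C. The maps ι and T(f), for f an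
-- embedding, preserve and reflect the order. Finitely many points of T^∞(C) have representatives
-- at a common level, and since ι reflects the order, the relation between them does not depend on
-- the level chosen; so each axiom of T^∞(C) is inherited from a finite stage. For density, between
-- the images of a ≠ b at level L lies the new point (a , 1) of level L + 1.

open import Defs
open import Level using (0ℓ)
open import Axiom.ExcludedMiddle using (ExcludedMiddle)
open import Data.Nat using (ℕ; zero; suc; _+_; _≤_; _⊔_)
open import Data.Nat.Properties
  using (+-comm; +-cancelʳ-≡; ≡-irrelevant; m≤m⊔n; m≤n⊔m; m≤n⇒m≤n⊔o; m≤n⇒m≤o⊔n; m≤n⇒∃[o]m+o≡n)
open import Data.Bool using (Bool; true; false)
open import Data.Product using (Σ; _×_; _,_; proj₁; proj₂)
open import Data.Product.Properties using (,-injectiveˡ; ,-injectiveʳ-UIP)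
open import Data.Sum using (_⊎_; inj₁; inj₂)
open import Data.Empty using (⊥; ⊥-elim)
open import Relation.Nullary using (¬_; yes; no)
open import Relation.Binary.PropositionalEquality
  using (_≡_; refl; sym; trans; cong; cong₂; module ≡-Reasoning)
  renaming (isEquivalence to ≡-isEquivalence)
open import Relation.Binary.Structures using (IsEquivalence)
open import Function using (_∘_; id; mk⇔; Equivalence)

no-three-distinct-Bools : {i j k : Bool} → ¬ (i ≡ j) → ¬ (j ≡ k) → ¬ (i ≡ k) → ⊥
no-three-distinct-Bools {false} {false}         i≢j _   _   = i≢j refl
no-three-distinct-Bools {true}  {true}          i≢j _   _   = i≢j refl
no-three-distinct-Bools {false} {true}  {false} _   _   i≢k = i≢k refl
no-three-distinct-Bools {false} {true}  {true}  _   j≢k _   = j≢k refl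
no-three-distinct-Bools {true}  {false} {false} _   j≢k _   = j≢k refl
no-three-distinct-Bools {true}  {false} {true}  _   _   i≢k = i≢k refl

module _ {A : Set} {RA : Ternary A} (cyc : IsCyclicOrder _≡_ RA) where
  open IsCyclicOrder cyc

  private
    TRA : Ternary (A × Bool)
    TRA = TR A RA

  R⇒x≢y : ∀ {a b c} → RA a b c → ¬ (a ≡ b)
  R⇒x≢y r refl = asymmetry r (cyclicity r) refl

  R⇒y≢z : ∀ {a b c} → RA a b c → ¬ (b ≡ c)
  R⇒y≢z r = R⇒x≢y (cyclicity r)

  R⇒z≢x : ∀ {a b c} → RA a b c → ¬ (c ≡ a)
  R⇒z≢x r = R⇒x≢y (cyclicity (cyclicity r))

  TR-cyclic : ∀ {x y z} → TRA x y z → TRA y z x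
  TR-cyclic {_ , _} {_ , _} {_ , _} (inj₁ r)                = inj₁ (cyclicity r)
  TR-cyclic {_ , _} {_ , _} {_ , _} (inj₂ (inj₁ d))         = inj₂ (inj₂ (inj₂ d))
  TR-cyclic {_ , _} {_ , _} {_ , _} (inj₂ (inj₂ (inj₁ d)))  = inj₂ (inj₁ d)
  TR-cyclic {_ , _} {_ , _} {_ , _} (inj₂ (inj₂ (inj₂ d)))  = inj₂ (inj₂ (inj₁ d))

  TR-irrefl₂₃ : ∀ {x y} → ¬ TRA x y y
  TR-irrefl₂₃ {_ , _} {_ , _} (inj₁ r)                                  = R⇒y≢z r refl
  TR-irrefl₂₃ {_ , _} {_ , _} (inj₂ (inj₁ (_ , b≢b , _)))               = b≢b refl
  TR-irrefl₂₃ {_ , _} {_ , _} (inj₂ (inj₂ (inj₁ (_ , _ , refl , ()))))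
  TR-irrefl₂₃ {_ , _} {_ , _} (inj₂ (inj₂ (inj₂ (b≡a , a≢b , _))))      = a≢b (sym b≡a)

  TR-trans : ∀ {a b c d i j k l} → TRA (a , i) (b , j) (c , k) → TRA (a , i) (c , k) (d , l) →
             TRA (a , i) (b , j) (d , l)
  TR-trans (inj₁ r) (inj₁ s) = inj₁ (transitivity r s)
  TR-trans (inj₁ r) (inj₂ (inj₁ (a≡c , _))) = ⊥-elim (R⇒z≢x r (sym a≡c))
  TR-trans (inj₁ r) (inj₂ (inj₂ (inj₁ (refl , _)))) = inj₁ r
  TR-trans (inj₁ r) (inj₂ (inj₂ (inj₂ (d≡a , _ , l<i)))) = inj₂ (inj₂ (inj₂ (d≡a , R⇒x≢y r , l<i)))
  TR-trans (inj₂ (inj₁ (a≡b , _ , refl , refl))) (inj₁ s) =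
    inj₂ (inj₁ (a≡b , (λ b≡d → R⇒z≢x s (trans (sym b≡d) (sym a≡b))) , refl , refl))
  TR-trans (inj₂ (inj₁ (a≡b , b≢c , _))) (inj₂ (inj₁ (a≡c , _))) = ⊥-elim (b≢c (trans (sym a≡b) a≡c))
  TR-trans (inj₂ (inj₁ (a≡b , _ , refl , refl))) (inj₂ (inj₂ (inj₁ (_ , d≢a , _)))) =
    inj₂ (inj₁ (a≡b , (λ b≡d → d≢a (trans (sym b≡d) (sym a≡b))) , refl , refl))
  TR-trans (inj₂ (inj₁ (_ , _ , refl , refl))) (inj₂ (inj₂ (inj₂ (_ , _ , refl , ()))))
  TR-trans (inj₂ (inj₂ (inj₁ (refl , _)))) (inj₁ s) = inj₁ s
  TR-trans (inj₂ (inj₂ (inj₁ (_ , c≢a , _)))) (inj₂ (inj₁ (a≡c , _))) = ⊥-elim (c≢a (sym a≡c))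
  TR-trans (inj₂ (inj₂ (inj₁ (_ , _ , refl , refl)))) (inj₂ (inj₂ (inj₁ (_ , _ , () , _))))
  TR-trans (inj₂ (inj₂ (inj₁ (b≡c , c≢a , _)))) (inj₂ (inj₂ (inj₂ (d≡a , _ , l<i)))) =
    inj₂ (inj₂ (inj₂ (d≡a , (λ a≡b → c≢a (trans (sym b≡c) (sym a≡b))) , l<i)))
  TR-trans (inj₂ (inj₂ (inj₂ (c≡a , _)))) (inj₁ s) = ⊥-elim (R⇒x≢y s (sym c≡a))
  TR-trans (inj₂ (inj₂ (inj₂ (_ , _ , refl , refl)))) (inj₂ (inj₁ (_ , _ , () , _)))
  TR-trans (inj₂ (inj₂ (inj₂ (c≡a , _)))) (inj₂ (inj₂ (inj₁ (c≡d , d≢a , _)))) =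
    ⊥-elim (d≢a (trans (sym c≡d) c≡a))
  TR-trans (inj₂ (inj₂ (inj₂ (c≡a , _)))) (inj₂ (inj₂ (inj₂ (_ , a≢c , _)))) = ⊥-elim (a≢c (sym c≡a))

  TR-asym : ∀ {x y z w} → TRA x y z → TRA x z w → ¬ (y ≡ w)
  TR-asym {_ , _} {_ , _} {_ , _} {_ , _} r s refl = TR-irrefl₂₃ (TR-trans r s)

  TR-connected-at-equal : ∀ {a b c i j k} → a ≡ b → ¬ (b ≡ c) → ¬ ((a , i) ≡ (b , j)) →
                          TRA (a , i) (b , j) (c , k) ⊎ TRA (c , k) (b , j) (a , i)
  TR-connected-at-equal {i = false} {false} refl _   ai≢bj = ⊥-elim (ai≢bj refl)
  TR-connected-at-equal {i = true}  {true}  refl _   ai≢bj = ⊥-elim (ai≢bj refl)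
  TR-connected-at-equal {i = false} {true}  refl b≢c _     = inj₁ (inj₂ (inj₁ (refl , b≢c , refl , refl)))
  TR-connected-at-equal {i = true}  {false} refl b≢c _     =
    inj₂ (inj₂ (inj₂ (inj₁ (refl , b≢c , refl , refl))))

  -- Connectedness is invariant under rotating the triple, so the cases b ≡ c and c ≡ a are
  -- rotations of the case a ≡ b.
  TR-connected : ExcludedMiddle 0ℓ → ∀ {x y z} → ¬ (x ≡ y) → ¬ (y ≡ z) → ¬ (x ≡ z) →
                 TRA x y z ⊎ TRA z y x
  TR-connected em {a , i} {b , j} {c , k} x≢y y≢z x≢z with em {a ≡ b} | em {b ≡ c} | em {c ≡ a}
  ... | yes refl | yes refl | _        =
    ⊥-elim (no-three-distinct-Bools (x≢y ∘ cong (a ,_)) (y≢z ∘ cong (a ,_)) (x≢z ∘ cong (a ,_)))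
  ... | yes a≡b | no b≢c  | _        = TR-connected-at-equal a≡b b≢c x≢y
  ... | no a≢b  | yes b≡c | _        with TR-connected-at-equal b≡c (a≢b ∘ sym ∘ trans b≡c) y≢z
  ...   | inj₁ r = inj₁ (TR-cyclic (TR-cyclic r))
  ...   | inj₂ r = inj₂ (TR-cyclic r)
  TR-connected em {a , i} {b , j} {c , k} x≢y y≢z x≢z | no a≢b | no b≢c | yes c≡a
    with TR-connected-at-equal c≡a a≢b (x≢z ∘ sym)
  ...   | inj₁ r = inj₁ (TR-cyclic r)
  ...   | inj₂ r = inj₂ (TR-cyclic (TR-cyclic r))
  TR-connected em {a , i} {b , j} {c , k} x≢y y≢z x≢z | no a≢b | no b≢c | no c≢a
    with connectedness a≢b b≢c (c≢a ∘ sym)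
  ...   | inj₁ r = inj₁ (inj₁ r)
  ...   | inj₂ r = inj₂ (inj₁ r)

  TR-isCyclicOrder : ExcludedMiddle 0ℓ → IsCyclicOrder _≡_ TRA
  TR-isCyclicOrder em = record
    { isEquivalence = ≡-isEquivalence
    ; resp          = λ { refl refl refl r → r }
    ; asymmetry     = TR-asym
    ; transitivity  = λ { {_ , _} {_ , _} {_ , _} {_ , _} r s → TR-trans r s }
    ; connectedness = TR-connected em
    ; cyclicity     = TR-cyclic
    }

Tⁿ-isCyclicOrder : ExcludedMiddle 0ℓ → {C : RawCyclic} → IsCyclicOrder _≡_ (R C) →
                   ∀ n → IsCyclicOrder _≡_ (R (Tⁿ n C))
Tⁿ-isCyclicOrder em cyc zero    = cyc
Tⁿ-isCyclicOrder em cyc (suc n) = TR-isCyclicOrder (Tⁿ-isCyclicOrder em cyc n) em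

ι-reflects : {A : Set} {RA : Ternary A} {a b c : A} → TR A RA (ι a) (ι b) (ι c) → RA a b c
ι-reflects (inj₁ r) = r
ι-reflects (inj₂ (inj₁ (_ , _ , _ , ())))
ι-reflects (inj₂ (inj₂ (inj₁ (_ , _ , _ , ()))))
ι-reflects (inj₂ (inj₂ (inj₂ (_ , _ , _ , ()))))

module Colimit (C : RawCyclic) where

  Tn : ℕ → Set
  Tn n = Carrier (Tⁿ n C)

  Rn : (n : ℕ) → Ternary (Tn n)
  Rn n = R (Tⁿ n C)

  _≈_ : T∞ C → T∞ C → Set
  _≈_ = _≈∞_ {C}

  ιs-preserves : ∀ k {n} {x y z : Tn n} → Rn n x y z → Rn (k + n) (ιs k x) (ιs k y) (ιs k z)
  ιs-preserves zero    r = r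
  ιs-preserves (suc k) r = inj₁ (ιs-preserves k r)

  ιs-reflects : ∀ k {n} {x y z : Tn n} → Rn (k + n) (ιs k x) (ιs k y) (ιs k z) → Rn n x y z
  ιs-reflects zero    r = r
  ιs-reflects (suc k) {n} r = ιs-reflects k (ι-reflects {RA = Rn (k + n)} r)

  ιs-injective : ∀ k {n} {x y : Tn n} → ιs k {n} {C} x ≡ ιs k y → x ≡ y
  ιs-injective zero    e = e
  ιs-injective (suc k) e = ιs-injective k (cong proj₁ e)

  raise-+ : ∀ k l (p : T∞ C) → raise k (raise l p) ≡ raise (k + l) p
  raise-+ zero    l p = refl
  raise-+ (suc k) l p = cong (raise 1) (raise-+ k l p)

  ≈-refl : ∀ {p} → p ≈ p
  ≈-refl = 0 , 0 , refl

  ≈-sym : ∀ {p q} → p ≈ q → q ≈ p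
  ≈-sym (k , l , e) = l , k , sym e

  ≈-trans : ∀ {p q r} → p ≈ q → q ≈ r → p ≈ r
  ≈-trans {p} {q} {r} (k , l , p~q) (k′ , l′ , q~r) = k′ + k , l + l′ , (begin
    raise (k′ + k) p     ≡⟨ sym (raise-+ k′ k p) ⟩
    raise k′ (raise k p) ≡⟨ cong (raise k′) p~q ⟩
    raise k′ (raise l q) ≡⟨ raise-+ k′ l q ⟩
    raise (k′ + l) q     ≡⟨ cong (λ m → raise m q) (+-comm k′ l) ⟩
    raise (l + k′) q     ≡⟨ sym (raise-+ l k′ q) ⟩
    raise l (raise k′ q) ≡⟨ cong (raise l) q~r ⟩
    raise l (raise l′ r) ≡⟨ raise-+ l l′ r ⟩
    raise (l + l′) r     ∎)
    where open ≡-Reasoning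

  ≈-isEquivalence : IsEquivalence _≈_
  ≈-isEquivalence = record { refl = ≈-refl ; sym = ≈-sym ; trans = ≈-trans }

  ≡⇒≈ : ∀ {p q} → p ≡ q → p ≈ q
  ≡⇒≈ refl = ≈-refl

  ≈-raise : ∀ k p → p ≈ raise k p
  ≈-raise k p = k , 0 , refl

  ≈⇒≡ : ∀ {n} {x y : Tn n} → (n , x) ≈ (n , y) → x ≡ y
  ≈⇒≡ {n} (k , l , e) with +-cancelʳ-≡ n k l (,-injectiveˡ e)
  ... | refl = ιs-injective k (,-injectiveʳ-UIP ≡-irrelevant e)

  ≈∧level≡⇒≡ : ∀ {p q} → p ≈ q → proj₁ p ≡ proj₁ q → p ≡ q
  ≈∧level≡⇒≡ {n , _} {.n , _} p≈q refl = cong (n ,_) (≈⇒≡ p≈q)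

  ≈⇒raise≡raise : ∀ {m n} {x : Tn m} {y : Tn n} → (m , x) ≈ (n , y) → raise n (m , x) ≡ raise m (n , y)
  ≈⇒raise≡raise {m} {n} {x} {y} x≈y =
    ≈∧level≡⇒≡ (≈-trans (≈-sym (≈-raise n (m , x))) (≈-trans x≈y (≈-raise m (n , y)))) (+-comm n m)

  AtLevel : ℕ → T∞ C → Set
  AtLevel L p = Σ (Tn L) λ x → p ≈ (L , x)

  atLevel : ∀ {L} p → proj₁ p ≤ L → AtLevel L p
  atLevel (n , x) n≤L with m≤n⇒∃[o]m+o≡n n≤L
  ... | o , refl rewrite +-comm n o = ιs o x , ≈-raise o (n , x)

  commonLevel : ∀ p q r s → Σ ℕ λ L → AtLevel L p × AtLevel L q × AtLevel L r × AtLevel L s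
  commonLevel p@(l₁ , _) q@(l₂ , _) r@(l₃ , _) s@(l₄ , _) =
    L , atLevel p (m≤n⇒m≤n⊔o (l₃ ⊔ l₄) (m≤m⊔n l₁ l₂)) , atLevel q (m≤n⇒m≤n⊔o (l₃ ⊔ l₄) (m≤n⊔m l₁ l₂))
      , atLevel r (m≤n⇒m≤o⊔n (l₁ ⊔ l₂) (m≤m⊔n l₃ l₄)) , atLevel s (m≤n⇒m≤o⊔n (l₁ ⊔ l₂) (m≤n⊔m l₃ l₄))
    where L = (l₁ ⊔ l₂) ⊔ (l₃ ⊔ l₄)

  R-subst : ∀ {m n} {x y z : Tn m} {x′ y′ z′ : Tn n} →
            _≡_ {A = T∞ C} (m , x) (n , x′) → _≡_ {A = T∞ C} (m , y) (n , y′) →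
            _≡_ {A = T∞ C} (m , z) (n , z′) → Rn m x y z → Rn n x′ y′ z′
  R-subst refl refl refl r = r

  -- Both triples are compared at level n + m, where they coincide.
  R-resp-≈ : ∀ {m n} {x y z : Tn m} {x′ y′ z′ : Tn n} →
             (m , x) ≈ (n , x′) → (m , y) ≈ (n , y′) → (m , z) ≈ (n , z′) → Rn m x y z → Rn n x′ y′ z′
  R-resp-≈ {m} {n} x≈ y≈ z≈ r =
    ιs-reflects m (R-subst (≈⇒raise≡raise x≈) (≈⇒raise≡raise y≈) (≈⇒raise≡raise z≈) (ιs-preserves n r))

  R∞⇒R : ∀ {p q r N} {x y z : Tn N} → R∞ {C} p q r → p ≈ (N , x) → q ≈ (N , y) → r ≈ (N , z) → Rn N x y z
  R∞⇒R (_ , _ , _ , _ , p≈ , q≈ , r≈ , r) p≈x q≈y r≈z =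
    R-resp-≈ (≈-trans (≈-sym p≈) p≈x) (≈-trans (≈-sym q≈) q≈y) (≈-trans (≈-sym r≈) r≈z) r

  ≉⇒≢ : ∀ {p q L} {x y : Tn L} → p ≈ (L , x) → q ≈ (L , y) → ¬ (p ≈ q) → ¬ (x ≡ y)
  ≉⇒≢ p≈x q≈y p≉q refl = p≉q (≈-trans p≈x (≈-sym q≈y))

  R∞-isCyclicOrder : ExcludedMiddle 0ℓ → IsCyclicOrder _≡_ (R C) → IsCyclicOrder _≈_ (R∞ {C})
  R∞-isCyclicOrder em cyc = record
    { isEquivalence = ≈-isEquivalence
    ; resp          = λ { x≈ y≈ z≈ (N , a , b , c , xa , yb , zc , r) →
                          N , a , b , c ,
                          ≈-trans (≈-sym x≈) xa , ≈-trans (≈-sym y≈) yb , ≈-trans (≈-sym z≈) zc , r }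
    ; asymmetry     = asymmetry
    ; transitivity  = transitivity
    ; connectedness = connectedness
    ; cyclicity     = λ { (N , a , b , c , xa , yb , zc , r) → N , b , c , a , yb , zc , xa , RN.cyclicity N r }
    }
    where
    module RN N = IsCyclicOrder (Tⁿ-isCyclicOrder em cyc N)

    asymmetry : ∀ {x y z w} → R∞ {C} x y z → R∞ {C} x z w → ¬ (y ≈ w)
    asymmetry {x} {y} {z} {w} r s y≈w with commonLevel x y z w
    ... | L , (a , xa) , (b , yb) , (c , zc) , (d , wd) =
      RN.asymmetry L (R∞⇒R r xa yb zc) (R∞⇒R s xa zc wd) (≈⇒≡ (≈-trans (≈-sym yb) (≈-trans y≈w wd)))

    transitivity : ∀ {x y z w} → R∞ {C} x y z → R∞ {C} x z w → R∞ {C} x y w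
    transitivity {x} {y} {z} {w} r s with commonLevel x y z w
    ... | L , (a , xa) , (b , yb) , (c , zc) , (d , wd) =
      L , a , b , d , xa , yb , wd , RN.transitivity L (R∞⇒R r xa yb zc) (R∞⇒R s xa zc wd)

    connectedness : ∀ {x y z} → ¬ (x ≈ y) → ¬ (y ≈ z) → ¬ (x ≈ z) → R∞ {C} x y z ⊎ R∞ {C} z y x
    connectedness {x} {y} {z} x≉y y≉z x≉z with commonLevel x y z z
    ... | L , (a , xa) , (b , yb) , (c , zc) , _
      with RN.connectedness L (≉⇒≢ xa yb x≉y) (≉⇒≢ yb zc y≉z) (≉⇒≢ xa zc x≉z)
    ...   | inj₁ r = inj₁ (L , a , b , c , xa , yb , zc , r)
    ...   | inj₂ r = inj₂ (L , c , b , a , zc , yb , xa , r)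

  ι∞-isEmbedding : IsEmbedding _≡_ (R C) _≈_ (R∞ {C}) (ι∞ {C})
  ι∞-isEmbedding = ≈⇒≡ , mk⇔ (λ r → 0 , _ , _ , _ , ≈-refl , ≈-refl , ≈-refl , r)
                             (λ r → R∞⇒R r ≈-refl ≈-refl ≈-refl)

  T∞-dense : Dense _≈_ (R∞ {C})
  T∞-dense {x} {z} x≉z with commonLevel x z z z
  ... | L , (a , xa) , (b , zb) , _ =
    (suc L , (a , true)) ,
    (suc L , ι a , (a , true) , ι b ,
     ≈-trans xa (≈-raise 1 (L , a)) , ≈-refl , ≈-trans zb (≈-raise 1 (L , b)) ,
     inj₂ (inj₁ (refl , ≉⇒≢ xa zb x≉z , refl , refl)))

  T∞-atLeastTwo : Carrier C → AtLeastTwo _≈_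
  T∞-atLeastTwo c = (1 , ι c) , (1 , (c , true)) , λ e → false≢true (cong proj₂ (≈⇒≡ e))
    where
    false≢true : ¬ (false ≡ true)
    false≢true ()

module _ {A B : Set} {RA : Ternary A} {RB : Ternary B} {f : A → B}
         (emb : IsEmbedding _≡_ RA _≡_ RB f) where
  private
    f-injective : ∀ {a b} → f a ≡ f b → a ≡ b
    f-injective = proj₁ emb

  Tmap-preserves : ∀ {x y z} → TR A RA x y z → TR B RB (Tmap f x) (Tmap f y) (Tmap f z)
  Tmap-preserves {_ , _} {_ , _} {_ , _} (inj₁ r) = inj₁ (Equivalence.to (proj₂ emb) r)
  Tmap-preserves {_ , _} {_ , _} {_ , _} (inj₂ (inj₁ (e , n , lt))) =
    inj₂ (inj₁ (cong f e , n ∘ f-injective , lt))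
  Tmap-preserves {_ , _} {_ , _} {_ , _} (inj₂ (inj₂ (inj₁ (e , n , lt)))) =
    inj₂ (inj₂ (inj₁ (cong f e , n ∘ f-injective , lt)))
  Tmap-preserves {_ , _} {_ , _} {_ , _} (inj₂ (inj₂ (inj₂ (e , n , lt)))) =
    inj₂ (inj₂ (inj₂ (cong f e , n ∘ f-injective , lt)))

  Tmap-reflects : ∀ {x y z} → TR B RB (Tmap f x) (Tmap f y) (Tmap f z) → TR A RA x y z
  Tmap-reflects {_ , _} {_ , _} {_ , _} (inj₁ r) = inj₁ (Equivalence.from (proj₂ emb) r)
  Tmap-reflects {_ , _} {_ , _} {_ , _} (inj₂ (inj₁ (e , n , lt))) =
    inj₂ (inj₁ (f-injective e , n ∘ cong f , lt))
  Tmap-reflects {_ , _} {_ , _} {_ , _} (inj₂ (inj₂ (inj₁ (e , n , lt)))) =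
    inj₂ (inj₂ (inj₁ (f-injective e , n ∘ cong f , lt)))
  Tmap-reflects {_ , _} {_ , _} {_ , _} (inj₂ (inj₂ (inj₂ (e , n , lt)))) =
    inj₂ (inj₂ (inj₂ (f-injective e , n ∘ cong f , lt)))

  Tmap-injective : ∀ {x y} → Tmap f x ≡ Tmap f y → x ≡ y
  Tmap-injective {_ , _} {_ , _} e = cong₂ _,_ (f-injective (cong proj₁ e)) (cong proj₂ e)

  Tmap-isEmbedding : IsEmbedding _≡_ (TR A RA) _≡_ (TR B RB) (Tmap f)
  Tmap-isEmbedding = Tmap-injective , mk⇔ Tmap-preserves Tmap-reflects

module _ {C D : RawCyclic} (f : Carrier C → Carrier D) where

  Tⁿmap-isEmbedding : IsEmbedding _≡_ (R C) _≡_ (R D) f →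
                      ∀ n → IsEmbedding _≡_ (R (Tⁿ n C)) _≡_ (R (Tⁿ n D)) (Tⁿmap n f)
  Tⁿmap-isEmbedding emb zero    = emb
  Tⁿmap-isEmbedding emb (suc n) =
    Tmap-isEmbedding {RA = R (Tⁿ n C)} {RB = R (Tⁿ n D)} (Tⁿmap-isEmbedding emb n)

  Tⁿmap-ιs : ∀ k {n} (x : Carrier (Tⁿ n C)) → Tⁿmap (k + n) f (ιs k {C = C} x) ≡ ιs k {C = D} (Tⁿmap n f x)
  Tⁿmap-ιs zero    x = refl
  Tⁿmap-ιs (suc k) x = cong ι (Tⁿmap-ιs k x)

  T∞map-raise : ∀ k p → T∞map f (raise k p) ≡ raise k (T∞map {C} {D} f p)
  T∞map-raise k (n , x) = cong (k + n ,_) (Tⁿmap-ιs k x)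

  T∞map-resp-≈ : ∀ {p q} → _≈∞_ {C} p q → _≈∞_ {D} (T∞map f p) (T∞map f q)
  T∞map-resp-≈ {p} {q} (k , l , e) = k , l , (begin
    raise k (T∞map f p) ≡⟨ sym (T∞map-raise k p) ⟩
    T∞map f (raise k p) ≡⟨ cong (T∞map f) e ⟩
    T∞map f (raise l q) ≡⟨ T∞map-raise l q ⟩
    raise l (T∞map f q) ∎)
    where open ≡-Reasoning

  T∞map-isEmbedding : IsEmbedding _≡_ (R C) _≡_ (R D) f →
                      IsEmbedding (_≈∞_ {C}) (R∞ {C}) (_≈∞_ {D}) (R∞ {D}) (T∞map f)
  T∞map-isEmbedding emb = injective , mk⇔ preserves reflects
    where
    open Colimit
    injective : ∀ {p q} → _≈∞_ {D} (T∞map f p) (T∞map f q) → _≈∞_ {C} p q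
    injective {p} {q} fp≈fq with commonLevel C p q q q
    ... | L , (x , p≈x) , (y , q≈y) , _ with proj₁ (Tⁿmap-isEmbedding emb L)
           (≈⇒≡ D (≈-trans D (≈-sym D (T∞map-resp-≈ p≈x)) (≈-trans D fp≈fq (T∞map-resp-≈ q≈y))))
    ...   | refl = ≈-trans C p≈x (≈-sym C q≈y)

    preserves : ∀ {p q r} → R∞ {C} p q r → R∞ {D} (T∞map f p) (T∞map f q) (T∞map f r)
    preserves (N , x , y , z , p≈x , q≈y , r≈z , r) =
      N , Tⁿmap N f x , Tⁿmap N f y , Tⁿmap N f z ,
      T∞map-resp-≈ p≈x , T∞map-resp-≈ q≈y , T∞map-resp-≈ r≈z ,
      Equivalence.to (proj₂ (Tⁿmap-isEmbedding emb N)) r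

    reflects : ∀ {p q r} → R∞ {D} (T∞map f p) (T∞map f q) (T∞map f r) → R∞ {C} p q r
    reflects {p} {q} {r} fr with commonLevel C p q r r
    ... | L , (x , p≈x) , (y , q≈y) , (z , r≈z) , _ =
      L , x , y , z , p≈x , q≈y , r≈z ,
      Equivalence.from (proj₂ (Tⁿmap-isEmbedding emb L))
        (R∞⇒R D fr (T∞map-resp-≈ p≈x) (T∞map-resp-≈ q≈y) (T∞map-resp-≈ r≈z))

Tⁿmap-id : {C : RawCyclic} (n : ℕ) (x : Carrier (Tⁿ n C)) → Tⁿmap n {C} {C} id x ≡ x
Tⁿmap-id zero    x       = refl
Tⁿmap-id (suc n) (x , i) = cong (_, i) (Tⁿmap-id n x)

Tⁿmap-∘ : {C D E : RawCyclic} (f : Carrier C → Carrier D) (g : Carrier D → Carrier E) (n : ℕ)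
          (x : Carrier (Tⁿ n C)) → Tⁿmap n {C} {E} (g ∘ f) x ≡ Tⁿmap n {D} {E} g (Tⁿmap n f x)
Tⁿmap-∘ f g zero    x       = refl
Tⁿmap-∘ f g (suc n) (x , i) = cong (_, i) (Tⁿmap-∘ f g n x)

T∞map-id : {C : RawCyclic} (p : T∞ C) → T∞map {C} {C} id p ≡ p
T∞map-id (n , x) = cong (n ,_) (Tⁿmap-id n x)

T∞map-∘ : {C D E : RawCyclic} (f : Carrier C → Carrier D) (g : Carrier D → Carrier E) (p : T∞ C) →
          T∞map {C} {E} (g ∘ f) p ≡ T∞map {D} {E} g (T∞map f p)
T∞map-∘ f g (n , x) = cong (n ,_) (Tⁿmap-∘ f g n x)

lemma3p6 : ExcludedMiddle 0ℓ →
  -- T^∞(C) is a cyclically ordered set and ι : C → T^∞(C) is an embedding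
  ((C : CyclicSet) →
      IsCyclicOrder (_≈∞_ {raw C}) (R∞ {raw C})
    × IsEmbedding _≡_ (R (raw C)) (_≈∞_ {raw C}) (R∞ {raw C}) (ι∞ {raw C}))
  -- T^∞ acts on embeddings: T^∞(f) is well defined, an embedding, and ι is natural
  × ((C D : CyclicSet) (f : Carrier (raw C) → Carrier (raw D)) → Embedding C D f →
        (∀ {p q} → _≈∞_ {raw C} p q → _≈∞_ {raw D} (T∞map f p) (T∞map f q))
      × IsEmbedding (_≈∞_ {raw C}) (R∞ {raw C}) (_≈∞_ {raw D}) (R∞ {raw D})
                    (T∞map {raw C} {raw D} f)
      × (∀ c → _≈∞_ {raw D} (T∞map {raw C} {raw D} f (ι∞ c)) (ι∞ (f c))))
  -- functoriality
  × ((C : CyclicSet) → ∀ p → _≈∞_ {raw C} (T∞map {raw C} {raw C} id p) p)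
  × ((C D E : CyclicSet)
     (f : Carrier (raw C) → Carrier (raw D)) (g : Carrier (raw D) → Carrier (raw E)) →
     Embedding C D f → Embedding D E g →
     ∀ p → _≈∞_ {raw E} (T∞map {raw C} {raw E} (g ∘ f) p)
                       (T∞map {raw D} {raw E} g (T∞map {raw C} {raw D} f p)))
  -- if C is nonempty, T^∞(C) is dense with at least two elements
  × ((C : CyclicSet) → Carrier (raw C) →
        Dense (_≈∞_ {raw C}) (R∞ {raw C}) × AtLeastTwo (_≈∞_ {raw C}))
lemma3p6 em =
    (λ C → R∞-isCyclicOrder (raw C) em (isCyclic C) , ι∞-isEmbedding (raw C))
  , (λ C D f emb → T∞map-resp-≈ f , T∞map-isEmbedding f emb , λ _ → ≈-refl (raw D))
  , (λ C p → ≡⇒≈ (raw C) (T∞map-id p))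
  , (λ C D E f g _ _ p → ≡⇒≈ (raw E) (T∞map-∘ f g p))
  , (λ C c → T∞-dense (raw C) , T∞-atLeastTwo (raw C) c)
  where open Colimit
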